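{- Let $h:\mathbb{Z}_{\ge0}\to\mathbb{Z}_{\ge0}$ be a monotonically increasing function with the NS-property. Let $y,z$ be nonnegative integers with $y\le h(z)$. Then: - $\mathcal{G}(CB_2(h,y,z))=0$ iff $y=z=0$; - $\mathcal{G}(CB_2(h,y,z))=1$ iff $(y,z)=(0,1)$; - $\mathcal{G}(CB_2(h,y,z))=2$ iff $(y,z)\in\{(0,2),(1,3)\}$; - $\mathcal{G}(CB_2(h,y,z))=3$ iff $(y,z)\in\{(0,3),(1,2)\}$; - $\mathcal{G}(CB_2(h,y,z))=4$ iff $(y,z)\in\{(0,4),(1,5),(2,6),(3,7)\}$; - $\mathcal{G}(CB_2(h,y,z))=5$ iff $(y,z)\in\{(0,5),(1,4),(2,7),(3,6)\}$; - $\mathcal{G}(CB_2(h,y,z))=6$ iff $(y,z)\in\{(0,6),(1,7),(2,4),(3,5)\}$; - $\mathcal{G}(CB_2(h,y,z))=7$ iff $(y,z)\in\{(0,7),(1,6),(2,5),(3,4)\}$; - $\mathcal{G}(CB_2(h,y,z))=8$ iff $(y,z)\in\{(0,8),(1,9),(2,10),(3,11),(4,12),(5,13),(6,14),(7,15)\}$.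
   Context: A function $h:\mathbb{Z}_{\ge0}\to\mathbb{Z}_{\ge0}$ is monotonically increasing if $h(u)\le h(v)$ whenever $u\le v$. Such an $h$ has the NS-property if both of the following hold: - $h(0)=0$; - for all $z,z'\in\mathbb{Z}_{\ge0}$ and every positive integer $i$, $\lfloor z/2^i\rfloor=\lfloor z'/2^i\rfloor$ implies $\lfloor h(z)/2^{i-1}\rfloor=\lfloor h(z')/2^{i-1}\rfloor$. The two-dimensional chocolate game for $h$ is an impartial game under normal play (the player with no legal move loses). Its positions are $CB_2(h,y,z)$ with $y,z\in\mathbb{Z}_{\ge0}$ and $y\le h(z)$. The options of $CB_2(h,y,z)$ are: - $CB_2(h,v,z)$ for each $v<y$; - $CB_2(h,\min(y,h(w)),w)$ for each $w<z$. $\mathcal{G}$ denotes the Sprague–Grundy value: $\mathcal{G}(g)=\mathrm{mex}\{\mathcal{G}(g'): g' \text{ an option of } g\}$, where $\mathrm{mex}(S)$ is the least nonnegative integer not in $S$. -}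

module Defs where

open import Data.Nat using (ℕ; zero; suc; _+_; _^_; _≤_; _⊓_; _≟_)
open import Data.Nat.DivMod using (_/_)
open import Data.Nat.Properties using (m^n≢0)
open import Data.List using (List; []; _∷_; _++_; [_]; map; length)
open import Data.List.Membership.DecPropositional _≟_ using (_∈?_)
open import Data.Product using (_×_; _,_)
open import Relation.Binary.PropositionalEquality using (_≡_)
open import Relation.Nullary using (yes; no)

_/2^_ : ℕ → ℕ → ℕ
z /2^ i = _/_ z (2 ^ i) {{m^n≢0 2 i}}

Monotone : (ℕ → ℕ) → Set
Monotone h = ∀ u v → u ≤ v → h u ≤ h v

-- NS-property; "every positive integer i" is written i = suc j
NSProperty : (ℕ → ℕ) → Set
NSProperty h =
  (h 0 ≡ 0) ×
  (∀ z z' j → z /2^ suc j ≡ z' /2^ suc j → h z /2^ j ≡ h z' /2^ j)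

-- mex of a finite list: least natural number not in the list
-- (the search from 0 with fuel length+1 always finds it, as mex ≤ length)
mexAux : List ℕ → ℕ → ℕ → ℕ
mexAux l zero n = n
mexAux l (suc k) n with n ∈? l
... | yes _ = mexAux l k (suc n)
... | no _  = n

mex : List ℕ → ℕ
mex l = mexAux l (suc (length l)) 0

-- Given, for each y, the list e y of Grundy values of the "column" options
-- CB₂(h, min(y,h w), w) (w < z) of position (y,z), compute the Grundy values
-- in the row z: rowList e y = [G(0,z), …, G(y-1,z)].
rowList : (ℕ → List ℕ) → ℕ → List ℕ
rowList e zero = []
rowList e (suc y) = rowList e y ++ [ mex (e y ++ rowList e y) ]

rowVal : (ℕ → List ℕ) → ℕ → ℕ
rowVal e y = mex (e y ++ rowList e y)

mutual
  prevRows : (ℕ → ℕ) → ℕ → List (ℕ × (ℕ → ℕ))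
  prevRows h zero = []
  prevRows h (suc z) = prevRows h z ++ [ (h z , grundyRow h z) ]

  -- grundyRow h z y = Sprague–Grundy value 𝒢(CB₂(h,y,z)): the mex over the
  -- options CB₂(h,v,z) (v < y) and CB₂(h,min(y,h w),w) (w < z).
  grundyRow : (ℕ → ℕ) → ℕ → ℕ → ℕ
  grundyRow h z = rowVal (λ y → map (λ p → colVal p y) (prevRows h z))
    where
    colVal : ℕ × (ℕ → ℕ) → ℕ → ℕ
    colVal (hw , g) y = g (y ⊓ hw)

𝒢CB₂ : (ℕ → ℕ) → ℕ → ℕ → ℕ
𝒢CB₂ h y z = grundyRow h z y

{-# OPTIONS --safe #-}
-- On the rows z < 16 the value of CB₂(h, y, z) is the nim-sum y ⊕ z, and beyond them it is at
-- least 9; the nine equivalences are then read off from y ⊕ z, using that y ≤ h z has fewer binary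
-- digits than z. The rows z < 16 only see h 0, …, h 15, which monotonicity and the NS-property
-- confine to finitely many profiles with values below 8. A search tree extending the profile one
-- value at a time checks, for each of them, that y ⊕ z solves the mex recursion defining the
-- Grundy values, and that recursion has only one solution.
module Submission where

open import Defs
open import Data.Nat
  using (ℕ; zero; suc; _+_; _*_; _∸_; _^_; _≤_; _<_; _⊓_; _⊔_; _≟_; _≤?_; _<?_; z≤n; s≤s)
open import Data.Nat.Properties
  using ( allUpTo?; ≤-refl; ≤-trans; ≤-<-trans; <-≤-trans; <-trans; ≤-antisym; ≤-pred; <⇒≤; ≤⇒≯; <⇒≱; ≮⇒≥
        ; m≤n⇒m<n∨m≡n; +-suc; m≤n+m; m≤m+n; n<1+n; n≤1+n; m⊓n≤n; ⊓-assoc; m≥n⇒m⊓n≡n; ∸-monoʳ-≤; m^n≢0)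
open import Data.Nat.DivMod using (_/_; _%_; m<n⇒m/n≡0; m/n≡0⇒m<n; 0/n≡0)
open import Data.Nat.Induction using (<-rec)
open import Data.List using (List; []; _∷_; _++_; [_]; _∷ʳ_; map; length; applyUpTo)
open import Data.List.Properties using (map-++; applyUpTo-∷ʳ; length-++-≤ˡ; length-applyUpTo)
open import Data.List.Membership.Propositional using (_∈_; _∉_)
open import Data.List.Membership.Propositional.Properties using (∈-applyUpTo⁺; ∈-applyUpTo⁻; ∈-++⁺ˡ; ∈-++⁻)
open import Data.List.Membership.DecPropositional _≟_ using (_∈?_)
open import Data.List.Relation.Unary.All using (all?; lookup)
open import Data.List.Relation.Unary.Any using (here)
open import Data.Product using (_×_; _,_; proj₁; proj₂; uncurry)
open import Data.Product.Properties using (≡-dec)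
open import Data.Sum using (_⊎_; inj₁; inj₂; [_,_]′)
open import Function using (_∘_)
open import Function.Bundles using (_⇔_; mk⇔; Equivalence)
open import Relation.Binary.PropositionalEquality
  using (_≡_; _≢_; refl; sym; trans; cong; cong₂; subst; module ≡-Reasoning)
open import Relation.Nullary using (¬_; Dec; yes; no; contradiction)
open import Relation.Nullary.Decidable using (_×-dec_; _→-dec_; map′; from-yes; True; toWitness)

open import Data.List.Membership.DecPropositional (≡-dec _≟_ _≟_) using () renaming (_∈?_ to _∈²_)

open ≡-Reasoning

module _ (l : List ℕ) where

  mexAux-minimal : ∀ f n {k} → n ≤ k → k < mexAux l f n → k ∈ l
  mexAux-minimal zero    n n≤k k<n = contradiction k<n (≤⇒≯ n≤k)
  mexAux-minimal (suc f) n n≤k k<r with n ∈? l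
  ... | no  _   = contradiction k<r (≤⇒≯ n≤k)
  ... | yes n∈l with m≤n⇒m<n∨m≡n n≤k
  ...   | inj₁ n<k  = mexAux-minimal f (suc n) n<k k<r
  ...   | inj₂ refl = n∈l

  mexAux-∉ : ∀ f n → mexAux l f n ∉ l ⊎ mexAux l f n ≡ f + n
  mexAux-∉ zero    n = inj₂ refl
  mexAux-∉ (suc f) n with n ∈? l
  ... | no  n∉l = inj₁ n∉l
  ... | yes _   with mexAux-∉ f (suc n)
  ...   | inj₁ r∉l = inj₁ r∉l
  ...   | inj₂ r≡  = inj₂ (trans r≡ (+-suc f n))

  mex-minimal : ∀ {k} → k < mex l → k ∈ l
  mex-minimal = mexAux-minimal (suc (length l)) 0 z≤n

  mex-∉ : mex l ≤ length l → mex l ∉ l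
  mex-∉ mex≤len with mexAux-∉ (suc (length l)) 0
  ... | inj₁ mex∉l = mex∉l
  ... | inj₂ mex≡  = contradiction (subst (_≤ length l) mex≡ mex≤len) (<⇒≱ (s≤s (m≤m+n (length l) 0)))

  mex-≥ : ∀ {m} → (∀ {k} → k < m → k ∈ l) → m ≤ length l → m ≤ mex l
  mex-≥ below m≤len = ≮⇒≥ λ mex<m → mex-∉ (≤-trans (<⇒≤ mex<m) m≤len) (below mex<m)

applyUpTo-cong : ∀ {A : Set} {f g : ℕ → A} n → (∀ {i} → i < n → f i ≡ g i) → applyUpTo f n ≡ applyUpTo g n
applyUpTo-cong zero    f≗g = refl
applyUpTo-cong (suc n) f≗g = cong₂ _∷_ (f≗g (s≤s z≤n)) (applyUpTo-cong n (f≗g ∘ s≤s))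

optionValues : (ℕ → ℕ) → (ℕ → ℕ → ℕ) → ℕ → ℕ → List ℕ
optionValues h g y z = applyUpTo (λ w → g (y ⊓ h w) w) z ++ applyUpTo (λ v → g v z) y

rowList-applyUpTo : ∀ e y → rowList e y ≡ applyUpTo (rowVal e) y
rowList-applyUpTo e zero    = refl
rowList-applyUpTo e (suc y) =
  trans (cong (_∷ʳ rowVal e y) (rowList-applyUpTo e y)) (applyUpTo-∷ʳ (rowVal e) y)

prevRows-applyUpTo : ∀ h y z →
  map (λ p → proj₂ p (y ⊓ proj₁ p)) (prevRows h z) ≡ applyUpTo (λ w → 𝒢CB₂ h (y ⊓ h w) w) z
prevRows-applyUpTo h y zero    = refl
prevRows-applyUpTo h y (suc z) = begin
  map column (prevRows h z ∷ʳ (h z , grundyRow h z))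
    ≡⟨ map-++ column (prevRows h z) [ (h z , grundyRow h z) ] ⟩
  map column (prevRows h z) ∷ʳ 𝒢CB₂ h (y ⊓ h z) z
    ≡⟨ cong (_∷ʳ 𝒢CB₂ h (y ⊓ h z) z) (prevRows-applyUpTo h y z) ⟩
  applyUpTo (λ w → 𝒢CB₂ h (y ⊓ h w) w) z ∷ʳ 𝒢CB₂ h (y ⊓ h z) z
    ≡⟨ applyUpTo-∷ʳ (λ w → 𝒢CB₂ h (y ⊓ h w) w) z ⟩
  applyUpTo (λ w → 𝒢CB₂ h (y ⊓ h w) w) (suc z) ∎
  where
  column : ℕ × (ℕ → ℕ) → ℕ
  column p = proj₂ p (y ⊓ proj₁ p)

𝒢CB₂-mex : ∀ h y z → 𝒢CB₂ h y z ≡ mex (optionValues h (𝒢CB₂ h) y z)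
𝒢CB₂-mex h y z = cong mex (cong₂ _++_ (prevRows-applyUpTo h y z) (rowList-applyUpTo _ y))

𝒢CB₂-unique : ∀ h (g : ℕ → ℕ → ℕ) n →
  (∀ {y z} → z < n → y ≤ h z → g y z ≡ mex (optionValues h g y z)) →
  ∀ {y z} → z < n → y ≤ h z → 𝒢CB₂ h y z ≡ g y z
𝒢CB₂-unique h g n g-mex {y} {z} = <-rec Agrees row-agrees z y
  where
  Agrees : ℕ → Set
  Agrees z = ∀ y → z < n → y ≤ h z → 𝒢CB₂ h y z ≡ g y z

  row-agrees : ∀ z → (∀ {w} → w < z → Agrees w) → Agrees z
  row-agrees z below = <-rec (λ y → z < n → y ≤ h z → 𝒢CB₂ h y z ≡ g y z) agrees-at
    where
    agrees-at : ∀ y → (∀ {v} → v < y → z < n → v ≤ h z → 𝒢CB₂ h v z ≡ g v z) →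
              z < n → y ≤ h z → 𝒢CB₂ h y z ≡ g y z
    agrees-at y left z<n y≤hz = begin
      𝒢CB₂ h y z                           ≡⟨ 𝒢CB₂-mex h y z ⟩
      mex (optionValues h (𝒢CB₂ h) y z)    ≡⟨ cong mex (cong₂ _++_ columns row) ⟩
      mex (optionValues h g y z)           ≡⟨ g-mex z<n y≤hz ⟨
      g y z                                ∎
      where
      columns = applyUpTo-cong z λ w<z → below w<z _ (<-trans w<z z<n) (m⊓n≤n y _)
      row     = applyUpTo-cong y λ v<y → left v<y z<n (≤-trans (<⇒≤ v<y) y≤hz)

-- The position (y ⊓ h 15, 15) is a column option of (y, z) of value at least 8, so its own
-- options reach every smaller value; its row options have value at least 9, and its column
-- options are column options of (y, z) as h is monotone. G stays abstract here because
-- conversion checking would otherwise unfold 𝒢CB₂, which takes time exponential in z.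
module _ {h : ℕ → ℕ} (mono : Monotone h) (h15≤7 : h 15 ≤ 7) (G : ℕ → ℕ → ℕ)
         (G-mex : ∀ y z → G y z ≡ mex (optionValues h G y z))
         (G-row-15 : ∀ {y} → y ≤ h 15 → G y 15 ≡ 15 ∸ y) where

  columns-cover : ∀ y {z k} → 15 < z → k ≤ 8 → k ∈ applyUpTo (λ w → G (y ⊓ h w) w) z
  columns-cover y {z} {k} 15<z k≤8 =
    [ via-option , (λ k≡q → subst (_∈ columns z) (sym k≡q) (∈-applyUpTo⁺ column 15<z)) ]′
      (m≤n⇒m<n∨m≡n (≤-trans k≤8 8≤q))
    where
    y' = y ⊓ h 15
    column : ℕ → ℕ
    column w = G (y ⊓ h w) w
    columns : ℕ → List ℕ
    columns = applyUpTo column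
    y'≤7 : y' ≤ 7
    y'≤7 = ≤-trans (m⊓n≤n y (h 15)) h15≤7
    8≤q : 8 ≤ G y' 15
    8≤q = subst (8 ≤_) (sym (G-row-15 (m⊓n≤n y (h 15)))) (∸-monoʳ-≤ 15 y'≤7)
    clip : ∀ {w} → w < 15 → y' ⊓ h w ≡ y ⊓ h w
    clip {w} w<15 = trans (⊓-assoc y (h 15) (h w)) (cong (y ⊓_) (m≥n⇒m⊓n≡n (mono w 15 (<⇒≤ w<15))))
    via-column : k ∈ applyUpTo (λ w → G (y' ⊓ h w) w) 15 → k ∈ columns z
    via-column k∈ = let (w , w<15 , k≡) = ∈-applyUpTo⁻ (λ w → G (y' ⊓ h w) w) k∈ in
      subst (_∈ columns z) (sym (trans k≡ (cong (λ t → G t w) (clip w<15))))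
            (∈-applyUpTo⁺ column (<-trans w<15 15<z))
    row-value : ∀ {v} → v < y' → 9 ≤ G v 15
    row-value v<y' = subst (9 ≤_) (sym (G-row-15 (<⇒≤ (<-≤-trans v<y' (m⊓n≤n y (h 15))))))
                           (∸-monoʳ-≤ 15 (≤-pred (<-≤-trans v<y' y'≤7)))
    via-row : k ∈ applyUpTo (λ v → G v 15) y' → k ∈ columns z
    via-row k∈ = let (v , v<y' , k≡) = ∈-applyUpTo⁻ (λ v → G v 15) k∈ in
      contradiction (subst (_≤ 8) k≡ k≤8) (<⇒≱ (row-value v<y'))
    via-option : k < G y' 15 → k ∈ columns z
    via-option k<q = [ via-column , via-row ]′ (∈-++⁻ (applyUpTo (λ w → G (y' ⊓ h w) w) 15) k∈options)
      where
      k∈options = mex-minimal (optionValues h G y' 15) (subst (k <_) (G-mex y' 15) k<q)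

  9≤value-beyond-15 : ∀ {y z} → 15 < z → 9 ≤ G y z
  9≤value-beyond-15 {y} {z} 15<z = subst (9 ≤_) (sym (G-mex y z))
    (mex-≥ (columns ++ row) (λ k<9 → ∈-++⁺ˡ (columns-cover y 15<z (≤-pred k<9))) 9≤length)
    where
    columns = applyUpTo (λ w → G (y ⊓ h w) w) z
    row = applyUpTo (λ v → G v z) y
    9≤length : 9 ≤ length (columns ++ row)
    9≤length = ≤-trans (≤-trans (m≤m+n 9 7) 15<z)
                       (subst (_≤ length (columns ++ row)) (length-applyUpTo (λ w → G (y ⊓ h w) w) z)
                              (length-++-≤ˡ columns))

ns-bound : ∀ {h} → NSProperty h → ∀ {z j} → z < 2 ^ suc j → h z < 2 ^ j
ns-bound {h} (h0≡0 , ns) {z} {j} z<2^1+j = m/n≡0⇒m<n {{m^n≢0 2 j}} (begin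
  h z /2^ j  ≡⟨ ns z 0 j z/2^1+j≡0/2^1+j ⟩
  h 0 /2^ j  ≡⟨ cong (_/2^ j) h0≡0 ⟩
  0 /2^ j    ≡⟨ 0/n≡0 (2 ^ j) {{m^n≢0 2 j}} ⟩
  0          ∎)
  where
  z/2^1+j≡0/2^1+j : z /2^ suc j ≡ 0 /2^ suc j
  z/2^1+j≡0/2^1+j = trans (m<n⇒m/n≡0 {{m^n≢0 2 (suc j)}} z<2^1+j)
                          (sym (0/n≡0 (2 ^ suc j) {{m^n≢0 2 (suc j)}}))

Consistent : ℕ → ℕ → ℕ → Set
Consistent n p a = p ≤ a × (∀ {j} → j < 4 → n /2^ suc j ≡ suc n /2^ suc j → p /2^ j ≡ a /2^ j)

consistent? : ∀ n p a → Dec (Consistent n p a)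
consistent? n p a =
  p ≤? a ×-dec allUpTo? (λ j → (n /2^ suc j ≟ suc n /2^ suc j) →-dec (p /2^ j ≟ a /2^ j)) 4

consistent : ∀ {h} → Monotone h → NSProperty h → ∀ n → Consistent n (h n) (h (suc n))
consistent mono (_ , ns) n = mono n (suc n) (n≤1+n n) , λ {j} _ → ns n (suc n) j

xorDigits : ℕ → ℕ → ℕ → ℕ
xorDigits zero    a b = 0
xorDigits (suc n) a b = (a + b) % 2 + 2 * xorDigits n (a / 2) (b / 2)

infixl 6 _⊕_

-- a ⊔ b binary digits suffice
_⊕_ : ℕ → ℕ → ℕ
a ⊕ b = xorDigits (a ⊔ b) a b

⊕-15 : ∀ {v} → v < 16 → v ⊕ 15 ≡ 15 ∸ v
⊕-15 = from-yes (allUpTo? (λ v → v ⊕ 15 ≟ 15 ∸ v) 16)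

RowCertified : (ℕ → ℕ) → ℕ → Set
RowCertified h z = ∀ {y} → y < suc (h z) → y ⊕ z ≡ mex (optionValues h _⊕_ y z)

rowCertified? : ∀ h z → Dec (RowCertified h z)
rowCertified? h z = allUpTo? (λ y → y ⊕ z ≟ mex (optionValues h _⊕_ y z)) (suc (h z))

rowCertified-cong : ∀ {f h : ℕ → ℕ} {z} → (∀ {w} → w ≤ z → f w ≡ h w) → RowCertified f z → RowCertified h z
rowCertified-cong {f} {h} {z} f≗h cert {y} y≤hz = begin
  y ⊕ z                          ≡⟨ cert (subst (λ t → y < suc t) (sym (f≗h ≤-refl)) y≤hz) ⟩
  mex (optionValues f _⊕_ y z)   ≡⟨ cong (λ cols → mex (cols ++ applyUpTo (λ v → v ⊕ z) y)) columns ⟩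
  mex (optionValues h _⊕_ y z)   ∎
  where
  columns : applyUpTo (λ w → (y ⊓ f w) ⊕ w) z ≡ applyUpTo (λ w → (y ⊓ h w) ⊕ w) z
  columns = applyUpTo-cong z λ {w} w<z → cong (λ t → (y ⊓ t) ⊕ w) (f≗h (<⇒≤ w<z))

extend : (ℕ → ℕ) → ℕ → ℕ → ℕ → ℕ
extend f n a w with w <? n
... | yes _ = f w
... | no  _ = a

extend-agrees : ∀ {f h : ℕ → ℕ} {n} → (∀ {w} → w ≤ n → f w ≡ h w) → ∀ {w} → w ≤ suc n → extend f (suc n) (h (suc n)) w ≡ h w
extend-agrees {h = h} {n} f≗h {w} w≤1+n with w <? suc n
... | yes w<1+n = f≗h (≤-pred w<1+n)
... | no  w≮1+n = cong h (≤-antisym (≮⇒≥ w≮1+n) w≤1+n)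

-- f holds a candidate for h 0, …, h n; every consistent next value is explored, d levels deep.
Certified : ℕ → (ℕ → ℕ) → ℕ → Set
Certified zero    f n = RowCertified f n
Certified (suc d) f n =
  RowCertified f n × (∀ {a} → a < 8 → Consistent n (f n) a → Certified d (extend f (suc n) a) (suc n))

certified? : ∀ d f n → Dec (Certified d f n)
certified? zero    f n = rowCertified? f n
certified? (suc d) f n =
  rowCertified? f n ×-dec
  allUpTo? (λ a → consistent? n (f n) a →-dec certified? d (extend f (suc n) a) (suc n)) 8

all-profiles-certified : Certified 15 (λ _ → 0) 0
all-profiles-certified = from-yes (certified? 15 (λ _ → 0) 0)

module _ {h : ℕ → ℕ} (mono : Monotone h) (ns : NSProperty h) where

  Certified⇒RowCertified : ∀ d {f n} → Certified d f n → (∀ {w} → w ≤ n → f w ≡ h w) →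
                           d + n < 16 → ∀ {z} → n ≤ z → z ≤ d + n → RowCertified h z
  Certified⇒RowCertified zero cert f≗h _ n≤z z≤0+n =
    subst (RowCertified h) (≤-antisym n≤z z≤0+n) (rowCertified-cong f≗h cert)
  Certified⇒RowCertified (suc d) {f} {n} (cert , next) f≗h d+n<16 {z} n≤z z≤ with m≤n⇒m<n∨m≡n n≤z
  ... | inj₂ refl = rowCertified-cong f≗h cert
  ... | inj₁ n<z  =
    Certified⇒RowCertified d (next h[1+n]<8 step) (extend-agrees f≗h) (subst (_< 16) (sym (+-suc d n)) d+n<16)
                  n<z (subst (z ≤_) (sym (+-suc d n)) z≤)
    where
    h[1+n]<8 : h (suc n) < 8
    h[1+n]<8 = ns-bound ns {j = 3} (≤-<-trans (s≤s (m≤n+m n d)) d+n<16)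
    step : Consistent n (f n) (h (suc n))
    step = subst (λ p → Consistent n p (h (suc n))) (sym (f≗h ≤-refl)) (consistent mono ns n)

  small-rows : ∀ {y z} → z < 16 → y ≤ h z → 𝒢CB₂ h y z ≡ y ⊕ z
  small-rows = 𝒢CB₂-unique h _⊕_ 16 λ z<16 y≤hz →
    Certified⇒RowCertified 15 {λ _ → 0} all-profiles-certified (λ { z≤n → sym (proj₁ ns) }) ≤-refl z≤n (≤-pred z<16) (s≤s y≤hz)

  large-rows : ∀ {y z} → 15 < z → 9 ≤ 𝒢CB₂ h y z
  large-rows = 9≤value-beyond-15 mono h15≤7 (𝒢CB₂ h) (𝒢CB₂-mex h) row-15
    where
    h15≤7 : h 15 ≤ 7
    h15≤7 = ≤-pred (ns-bound ns {j = 3} (n<1+n 15))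
    row-15 : ∀ {y} → y ≤ h 15 → 𝒢CB₂ h y 15 ≡ 15 ∸ y
    row-15 y≤h15 = trans (small-rows (n<1+n 15) y≤h15)
                         (⊕-15 (s≤s (≤-trans y≤h15 (≤-trans h15≤7 (m≤m+n 7 8)))))

Classification : ℕ → ℕ → ℕ → Set
Classification g y z =
  ((g ≡ 0) ⇔ ((y ≡ 0) × (z ≡ 0))) ×
  ((g ≡ 1) ⇔ ((y , z) ≡ (0 , 1))) ×
  ((g ≡ 2) ⇔ ((y , z) ∈ (0 , 2) ∷ (1 , 3) ∷ [])) ×
  ((g ≡ 3) ⇔ ((y , z) ∈ (0 , 3) ∷ (1 , 2) ∷ [])) ×
  ((g ≡ 4) ⇔ ((y , z) ∈ (0 , 4) ∷ (1 , 5) ∷ (2 , 6) ∷ (3 , 7) ∷ [])) ×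
  ((g ≡ 5) ⇔ ((y , z) ∈ (0 , 5) ∷ (1 , 4) ∷ (2 , 7) ∷ (3 , 6) ∷ [])) ×
  ((g ≡ 6) ⇔ ((y , z) ∈ (0 , 6) ∷ (1 , 7) ∷ (2 , 4) ∷ (3 , 5) ∷ [])) ×
  ((g ≡ 7) ⇔ ((y , z) ∈ (0 , 7) ∷ (1 , 6) ∷ (2 , 5) ∷ (3 , 4) ∷ [])) ×
  ((g ≡ 8) ⇔ ((y , z) ∈ (0 , 8) ∷ (1 , 9) ∷ (2 , 10) ∷ (3 , 11) ∷ (4 , 12) ∷ (5 , 13) ∷ (6 , 14) ∷ (7 , 15) ∷ []))

_⇔?_ : ∀ {A B : Set} → Dec A → Dec B → Dec (A ⇔ B)
a? ⇔? b? = map′ (uncurry mk⇔) (λ a⇔b → Equivalence.to a⇔b , Equivalence.from a⇔b)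
                ((a? →-dec b?) ×-dec (b? →-dec a?))

classification? : ∀ g y z → Dec (Classification g y z)
classification? g y z =
  ((g ≟ 0) ⇔? ((y ≟ 0) ×-dec (z ≟ 0))) ×-dec
  ((g ≟ 1) ⇔? (≡-dec _≟_ _≟_ (y , z) (0 , 1))) ×-dec
  ((g ≟ 2) ⇔? ((y , z) ∈² _)) ×-dec
  ((g ≟ 3) ⇔? ((y , z) ∈² _)) ×-dec
  ((g ≟ 4) ⇔? ((y , z) ∈² _)) ×-dec
  ((g ≟ 5) ⇔? ((y , z) ∈² _)) ×-dec
  ((g ≟ 6) ⇔? ((y , z) ∈² _)) ×-dec
  ((g ≟ 7) ⇔? ((y , z) ∈² _)) ×-dec
  ((g ≟ 8) ⇔? ((y , z) ∈² _))

classification-small : ∀ {y z} → z < 16 → (∀ {j} → j < 4 → z < 2 ^ suc j → y < 2 ^ j) →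
                       Classification (y ⊕ z) y z
classification-small z<16 fewerDigits = table z<16 (fewerDigits (n<1+n 3) z<16) fewerDigits
  where
  table : ∀ {z} → z < 16 → ∀ {y} → y < 8 → (∀ {j} → j < 4 → z < 2 ^ suc j → y < 2 ^ j) →
          Classification (y ⊕ z) y z
  table = from-yes (allUpTo? (λ z → allUpTo? (λ y →
            allUpTo? (λ j → (z <? 2 ^ suc j) →-dec (y <? 2 ^ j)) 4 →-dec classification? (y ⊕ z) y z) 8) 16)

classification-large : ∀ {g y z} → 9 ≤ g → 16 ≤ z → Classification g y z
classification-large {g} {y} {z} 9≤g 16≤z =
  neither (differs _) (λ (y≡0 , z≡0) → outside {(0 , 0) ∷ []} _ (here (cong₂ _,_ y≡0 z≡0))) ,
  neither (differs _) (outside {(0 , 1) ∷ []} _ ∘ here) ,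
  neither (differs _) (outside _) ,
  neither (differs _) (outside _) ,
  neither (differs _) (outside _) ,
  neither (differs _) (outside _) ,
  neither (differs _) (outside _) ,
  neither (differs _) (outside _) ,
  neither (differs _) (outside _)
  where
  neither : ∀ {A B : Set} → ¬ A → ¬ B → A ⇔ B
  neither ¬a ¬b = mk⇔ (λ a → contradiction a ¬a) (λ b → contradiction b ¬b)
  differs : ∀ {k} → True (k <? 9) → g ≢ k
  differs k<9 refl = <⇒≱ (toWitness k<9) 9≤g
  outside : ∀ {L} → True (all? (λ p → proj₂ p <? 16) L) → (y , z) ∉ L
  outside L-small yz∈L = <⇒≱ (lookup (toWitness L-small) yz∈L) 16≤z

lemma3 : (h : ℕ → ℕ) → Monotone h → NSProperty h →
    (y z : ℕ) → y ≤ h z →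
      ((𝒢CB₂ h y z ≡ 0) ⇔ ((y ≡ 0) × (z ≡ 0))) ×
      ((𝒢CB₂ h y z ≡ 1) ⇔ ((y , z) ≡ (0 , 1))) ×
      ((𝒢CB₂ h y z ≡ 2) ⇔ ((y , z) ∈ (0 , 2) ∷ (1 , 3) ∷ [])) ×
      ((𝒢CB₂ h y z ≡ 3) ⇔ ((y , z) ∈ (0 , 3) ∷ (1 , 2) ∷ [])) ×
      ((𝒢CB₂ h y z ≡ 4) ⇔ ((y , z) ∈ (0 , 4) ∷ (1 , 5) ∷ (2 , 6) ∷ (3 , 7) ∷ [])) ×
      ((𝒢CB₂ h y z ≡ 5) ⇔ ((y , z) ∈ (0 , 5) ∷ (1 , 4) ∷ (2 , 7) ∷ (3 , 6) ∷ [])) ×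
      ((𝒢CB₂ h y z ≡ 6) ⇔ ((y , z) ∈ (0 , 6) ∷ (1 , 7) ∷ (2 , 4) ∷ (3 , 5) ∷ [])) ×
      ((𝒢CB₂ h y z ≡ 7) ⇔ ((y , z) ∈ (0 , 7) ∷ (1 , 6) ∷ (2 , 5) ∷ (3 , 4) ∷ [])) ×
      ((𝒢CB₂ h y z ≡ 8) ⇔ ((y , z) ∈ (0 , 8) ∷ (1 , 9) ∷ (2 , 10) ∷ (3 , 11) ∷ (4 , 12) ∷ (5 , 13) ∷ (6 , 14) ∷ (7 , 15) ∷ []))
lemma3 h mono ns y z y≤hz with z <? 16
... | yes z<16 = subst (λ g → Classification g y z) (sym (small-rows mono ns z<16 y≤hz))
                   (classification-small z<16 λ {j} _ z<2^1+j → ≤-<-trans y≤hz (ns-bound ns {j = j} z<2^1+j))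
... | no  z≮16 = classification-large (large-rows mono ns (≮⇒≥ z≮16)) (≮⇒≥ z≮16)
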